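{- Let $\{2\}$ denote the game whose only option is the Nim heap of size $2$. If $G$ is a game such that $G+\{2\}$ is not of type $\mathcal Q$, then $G$ is identical to $0$.
   Context: A (finite impartial) game is defined recursively as a finite set of games, its options; $0$ is the game with no options. Games $G,H$ are identical iff every option of $G$ is identical to some option of $H$ and vice versa. Three players alternate moves cyclically; a move replaces the current game by one of its options, and the player who makes the last move wins. The disjunctive sum $G+H$ is the game whose options are all $G'+H$ and all $G+H'$. Types are defined recursively: $G$ is of type $\mathcal N$ iff it has some option of type $\mathcal P$; of type $\mathcal O$ iff it has at least one option and all its options are of type $\mathcal N$; of type $\mathcal P$ iff all its options are of type $\mathcal O$; of type $\mathcal Q$ otherwise. The Nim heap of size $n$ is the game whose options are the heaps of sizes $0,1,\dots,n-1$. -}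

module Defs where

open import Data.List using (List; []; _∷_; _++_)
open import Data.List.Relation.Unary.All using (All)
open import Data.List.Relation.Unary.Any using (Any)
open import Data.Nat using (ℕ; zero; suc)
open import Data.Bool using (Bool; true; false; _∧_; if_then_else_)
open import Data.List using (null)
open import Data.Bool.ListAction using (any; all)

-- A finite impartial game, given by its (finite) list of options.
-- (Lists may repeat/reorder options; "identical" below is the set-level identity.)
data Game : Set where
  mk : List Game → Game

options : Game → List Game
options (mk gs) = gs

zeroG : Game
zeroG = mk []

data _≅_ : Game → Game → Set where
  ident : ∀ {gs hs} →
          All (λ g → Any (λ h → g ≅ h) hs) gs →
          All (λ h → Any (λ g → g ≅ h) gs) hs →
          mk gs ≅ mk hs

mutual
  _⊕_ : Game → Game → Game
  g@(mk gs) ⊕ h@(mk hs) = mk (addL gs h ++ addR g hs)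

  addL : List Game → Game → List Game
  addL [] h = []
  addL (g′ ∷ gs) h = (g′ ⊕ h) ∷ addL gs h

  addR : Game → List Game → List Game
  addR g [] = []
  addR g (h′ ∷ hs) = (g ⊕ h′) ∷ addR g hs

-- The four types (outcome classes) for three-player games.
data Ty : Set where
  N O P Q : Ty

-- Types are defined recursively (the four cases are mutually exclusive, so
-- checking them in the order N, O, P, Q is just the definition):
--   N iff some option is P;
--   O iff at least one option and all options are N;
--   P iff all options are O;
--   Q otherwise.
isN isO isP : Ty → Bool
isN N = true
isN _ = false
isO O = true
isO _ = false
isP P = true
isP _ = false

classify : List Ty → Ty
classify ts =
  if any isP ts then N
  else if (not′ (null ts) ∧ all isN ts) then O
  else if all isO ts then P
  else Q
  where
  not′ : Bool → Bool
  not′ true = false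
  not′ false = true

mutual
  type : Game → Ty
  type (mk gs) = classify (types gs)

  types : List Game → List Ty
  types [] = []
  types (g ∷ gs) = type g ∷ types gs

nimOpts : ℕ → List Game
nimOpts zero = []
nimOpts (suc n) = mk (nimOpts n) ∷ nimOpts n

nim : ℕ → Game
nim n = mk (nimOpts n)

brace2 : Game
brace2 = mk (nim 2 ∷ [])

{-# OPTIONS --safe #-}
module Submission where

-- The options of G + {2} are the sums G' + {2}, which are Q by induction or,
-- for G' = 0, the game {2} of type O, together with G + *2. The latter is never P: otherwise
-- G + *1 and G + *0 would both be O, but G + *1 being O forces its option G + *0 to be N.
-- So G + {2} has no P-option, and, G having an option, not all its options are N. Not all are
-- O either: some G' + {2} is Q, unless every G' is 0; then G has the P-option 0, so neither
-- option *1, G of G + *1 is P, hence G + *1 is not N and G + *2 is not O.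

open import Defs
open import Data.Bool using (true; false; T)
open import Data.Bool.ListAction using (any; all)
open import Data.Empty using (⊥-elim)
open import Data.List using (List; []; _∷_; _++_; map)
open import Data.List.Properties using (++-identityʳ)
open import Data.List.Relation.Unary.All as All using (All; []; _∷_)
open import Data.List.Relation.Unary.All.Properties as All using (all⁺; All¬⇒¬Any; Any¬⇒¬All)
open import Data.List.Relation.Unary.Any as Any using (Any; here; there)
open import Data.List.Relation.Unary.Any.Properties as Any using (any⁻)
open import Data.Sum as Sum using (_⊎_; inj₁; inj₂)
open import Data.Unit using (tt)
open import Function using (_∘_)
open import Relation.Binary.PropositionalEquality using (_≡_; _≢_; refl; sym; trans; cong; cong₂; subst)
open import Relation.Nullary using (¬_)
open import Relation.Unary using (Pred)

T-isN : ∀ {t} → T (isN t) → t ≡ N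
T-isN {N} _ = refl
T-isN {O} ()
T-isN {P} ()
T-isN {Q} ()

T-isO : ∀ {t} → T (isO t) → t ≡ O
T-isO {N} ()
T-isO {O} _ = refl
T-isO {P} ()
T-isO {Q} ()

T-isP : ∀ {t} → T (isP t) → t ≡ P
T-isP {N} ()
T-isP {O} ()
T-isP {P} _ = refl
T-isP {Q} ()

types≡map : ∀ gs → types gs ≡ map type gs
types≡map []       = refl
types≡map (g ∷ gs) = cong (type g ∷_) (types≡map gs)

module _ {ℓ} {Pr : Pred Ty ℓ} where

  Any-types⁻ : ∀ gs → Any Pr (types gs) → Any (Pr ∘ type) gs
  Any-types⁻ gs = Any.map⁻ ∘ subst (Any Pr) (types≡map gs)

  All-types⁻ : ∀ gs → All Pr (types gs) → All (Pr ∘ type) gs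
  All-types⁻ gs = All.map⁻ ∘ subst (All Pr) (types≡map gs)

data Outcome (gs : List Game) : Ty → Set where
  some-P : Any (λ g → type g ≡ P) gs → Outcome gs N
  all-N  : All (λ g → type g ≡ N) gs → Outcome gs O
  all-O  : All (λ g → type g ≡ O) gs → Outcome gs P
  other  : Outcome gs Q

outcome : ∀ G → Outcome (options G) (type G)
outcome (mk []) = all-O []
outcome (mk gs@(_ ∷ _)) with any isP (types gs) | any⁻ isP (types gs)
... | true  | someP = some-P (Any-types⁻ gs (Any.map T-isP (someP tt)))
... | false | _ with all isN (types gs) | all⁺ isN (types gs)
...   | true  | allN = all-N (All-types⁻ gs (All.map T-isN (allN tt)))
...   | false | _ with all isO (types gs) | all⁺ isO (types gs)
...     | true  | allO = all-O (All-types⁻ gs (All.map T-isO (allO tt)))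
...     | false | _ = other

type≡N⇒ : ∀ G → type G ≡ N → Any (λ g → type g ≡ P) (options G)
type≡N⇒ G eq with some-P someP ← subst (Outcome (options G)) eq (outcome G) = someP

type≡O⇒ : ∀ G → type G ≡ O → All (λ g → type g ≡ N) (options G)
type≡O⇒ G eq with all-N allN ← subst (Outcome (options G)) eq (outcome G) = allN

type≡P⇒ : ∀ G → type G ≡ P → All (λ g → type g ≡ O) (options G)
type≡P⇒ G eq with all-O allO ← subst (Outcome (options G)) eq (outcome G) = allO

type≡Q⇐ : ∀ G → All (λ g → type g ≢ P) (options G) → Any (λ g → type g ≢ N) (options G) →
          Any (λ g → type g ≢ O) (options G) → type G ≡ Q
type≡Q⇐ G noP notAllN notAllO with type G | outcome G
... | N | some-P someP = ⊥-elim (All¬⇒¬Any noP someP)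
... | O | all-N allN   = ⊥-elim (Any¬⇒¬All notAllN allN)
... | P | all-O allO   = ⊥-elim (Any¬⇒¬All notAllO allO)
... | Q | other        = refl

addL≡map : ∀ gs H → addL gs H ≡ map (_⊕ H) gs
addL≡map []       H = refl
addL≡map (g ∷ gs) H = cong (g ⊕ H ∷_) (addL≡map gs H)

addR≡map : ∀ G hs → addR G hs ≡ map (G ⊕_) hs
addR≡map G []       = refl
addR≡map G (h ∷ hs) = cong (G ⊕ h ∷_) (addR≡map G hs)

options-⊕ : ∀ G H → options (G ⊕ H) ≡ map (_⊕ H) (options G) ++ map (G ⊕_) (options H)
options-⊕ (mk gs) (mk hs) = cong₂ _++_ (addL≡map gs (mk hs)) (addR≡map (mk gs) hs)

mutual
  ⊕-identityʳ : ∀ G → G ⊕ zeroG ≡ G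
  ⊕-identityʳ (mk gs) = cong mk (trans (++-identityʳ (addL gs zeroG)) (addL-identityʳ gs))

  addL-identityʳ : ∀ gs → addL gs zeroG ≡ gs
  addL-identityʳ []       = refl
  addL-identityʳ (g ∷ gs) = cong₂ _∷_ (⊕-identityʳ g) (addL-identityʳ gs)

module _ {ℓ} {Pr : Pred Game ℓ} (G H : Game) where

  All-options-⊕⁺ : All (λ g → Pr (g ⊕ H)) (options G) → All (λ h → Pr (G ⊕ h)) (options H) →
                   All Pr (options (G ⊕ H))
  All-options-⊕⁺ left right =
    subst (All Pr) (sym (options-⊕ G H)) (All.++⁺ (All.map⁺ left) (All.map⁺ right))

  All-options-⊕⁻ʳ : All Pr (options (G ⊕ H)) → All (λ h → Pr (G ⊕ h)) (options H)
  All-options-⊕⁻ʳ = All.map⁻ ∘ All.++⁻ʳ (map (_⊕ H) (options G)) ∘ subst (All Pr) (options-⊕ G H)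

  Any-options-⊕⁺ˡ : Any (λ g → Pr (g ⊕ H)) (options G) → Any Pr (options (G ⊕ H))
  Any-options-⊕⁺ˡ = subst (Any Pr) (sym (options-⊕ G H)) ∘ Any.++⁺ˡ ∘ Any.map⁺

  Any-options-⊕⁺ʳ : Any (λ h → Pr (G ⊕ h)) (options H) → Any Pr (options (G ⊕ H))
  Any-options-⊕⁺ʳ =
    subst (Any Pr) (sym (options-⊕ G H)) ∘ Any.++⁺ʳ (map (_⊕ H) (options G)) ∘ Any.map⁺

type-⊕-nim2≢P : ∀ G → type (G ⊕ nim 2) ≢ P
type-⊕-nim2≢P G G⊕2:P with All-options-⊕⁻ʳ G (nim 2) (type≡P⇒ (G ⊕ nim 2) G⊕2:P)
... | G⊕1:O ∷ G⊕0:O ∷ [] with All-options-⊕⁻ʳ G (nim 1) (type≡O⇒ (G ⊕ nim 1) G⊕1:O)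
...   | G⊕0:N ∷ [] with () ← trans (sym G⊕0:N) G⊕0:O

type-⊕-nim2≢O : ∀ G → All (_≡ zeroG) (options G) → type (G ⊕ nim 2) ≢ O
type-⊕-nim2≢O (mk [])       []               ()
type-⊕-nim2≢O G@(mk (_ ∷ _)) zeros@(refl ∷ _) G⊕2:O =
  All¬⇒¬Any G⊕1-options≢P (type≡N⇒ (G ⊕ nim 1) G⊕1:N)
  where
  G≢P : type G ≢ P
  G≢P G:P with () ← All.head (type≡P⇒ G G:P)

  G⊕1-options≢P : All (λ g → type g ≢ P) (options (G ⊕ nim 1))
  G⊕1-options≢P = All-options-⊕⁺ G (nim 1) (All.map (λ { refl () }) zeros)
                                            (subst (λ g → type g ≢ P) (sym (⊕-identityʳ G)) G≢P ∷ [])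

  G⊕1:N : type (G ⊕ nim 1) ≡ N
  G⊕1:N = All.head (All-options-⊕⁻ʳ G (nim 2) (type≡O⇒ (G ⊕ nim 2) G⊕2:O))

All⊎⇒All⊎Any : ∀ {a p q} {A : Set a} {P : Pred A p} {Q : Pred A q} {xs} →
               All (λ x → P x ⊎ Q x) xs → All P xs ⊎ Any Q xs
All⊎⇒All⊎Any []              = inj₁ []
All⊎⇒All⊎Any (inj₁ px ∷ pqs) = Sum.map (px ∷_) there (All⊎⇒All⊎Any pqs)
All⊎⇒All⊎Any (inj₂ qx ∷ _)   = inj₂ (here qx)

ZeroOrQ : Game → Set
ZeroOrQ G = G ≡ zeroG ⊎ type (G ⊕ brace2) ≡ Q

type-⊕-brace2≡Q : ∀ g gs → All ZeroOrQ (g ∷ gs) → type (mk (g ∷ gs) ⊕ brace2) ≡ Q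
type-⊕-brace2≡Q g gs options-ZeroOrQ = type≡Q⇐ (G ⊕ brace2) noP notAllN notAllO
  where
  G = mk (g ∷ gs)

  -- 0 ⊕ brace2 computes to {2}, whose only option *2 is N, so it is of type O.
  ⊕brace2≢ : ∀ {h t} → O ≢ t → Q ≢ t → ZeroOrQ h → type (h ⊕ brace2) ≢ t
  ⊕brace2≢ O≢t Q≢t (inj₁ refl)  = O≢t
  ⊕brace2≢ O≢t Q≢t (inj₂ h⊕2:Q) = Q≢t ∘ trans (sym h⊕2:Q)

  ≡Q⇒≢O : ∀ {t} → t ≡ Q → t ≢ O
  ≡Q⇒≢O refl ()

  noP : All (λ h → type h ≢ P) (options (G ⊕ brace2))
  noP = All-options-⊕⁺ G brace2 (All.map (⊕brace2≢ (λ ()) (λ ())) options-ZeroOrQ)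
                                (type-⊕-nim2≢P G ∷ [])

  notAllN : Any (λ h → type h ≢ N) (options (G ⊕ brace2))
  notAllN = Any-options-⊕⁺ˡ G brace2 (here (⊕brace2≢ (λ ()) (λ ()) (All.head options-ZeroOrQ)))

  notAllO : Any (λ h → type h ≢ O) (options (G ⊕ brace2))
  notAllO with All⊎⇒All⊎Any options-ZeroOrQ
  ... | inj₁ zeros = Any-options-⊕⁺ʳ G brace2 (here (type-⊕-nim2≢O G zeros))
  ... | inj₂ someQ = Any-options-⊕⁺ˡ G brace2 (Any.map ≡Q⇒≢O someQ)

mutual
  zero-or-Q : ∀ G → ZeroOrQ G
  zero-or-Q (mk [])       = inj₁ refl
  zero-or-Q (mk (g ∷ gs)) = inj₂ (type-⊕-brace2≡Q g gs (all-zero-or-Q (g ∷ gs)))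

  all-zero-or-Q : ∀ gs → All ZeroOrQ gs
  all-zero-or-Q []       = []
  all-zero-or-Q (g ∷ gs) = zero-or-Q g ∷ all-zero-or-Q gs

claim13 : (G : Game) → ¬ (type (G ⊕ brace2) ≡ Q) → G ≅ zeroG
claim13 G G⊕2≢Q with zero-or-Q G
... | inj₁ refl   = ident [] []
... | inj₂ G⊕2:Q = ⊥-elim (G⊕2≢Q G⊕2:Q)
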